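{- Let $n\in\{3,4\}$ and let $G$ be the $n\times n$ toroidal chess graph. Play Cops and Robbers on $G$ with every cop moving as a knight and the robber moving on foot. Then $c(G)=2$.
   Context: The $n\times n$ toroidal chess graph has vertex set $\mathbb{Z}_n\times\mathbb{Z}_n$, where $(i,j)$ is row $i$, column $j$; indices are taken mod $n$. Two vertices are adjacent if they differ by $\pm1$ in exactly one coordinate and agree in the other. Cops and Robbers with one robber is played as follows. The $k$ cops choose starting vertices (several cops may share a vertex), then the robber chooses a starting vertex. After that the cops and the robber alternate turns, cops first. On the cops' turn, each cop either stays where it is or moves to one of its allowable vertices. On the robber's turn, the robber either stays or moves to one of his allowable vertices. The cops win if, after finitely many moves, some cop occupies the robber's vertex. The robber wins if he can guarantee that this never happens. A player on foot at $(i,j)$ has as allowable vertices the four vertices adjacent to $(i,j)$. A player moving as a knight at $(i,j)$ has as allowable vertices $(i\pm1,j\pm2)$ and $(i\pm2,j\pm1)$ (all sign choices, mod $n$). The cop number $c(G)$ is the minimum number of cops for which the cops have a winning strategy, whatever the robber's starting position. -}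

module Defs where

open import Data.Nat using (ℕ; zero; suc; _+_; _∸_; _<_; NonZero)
open import Data.Nat.DivMod using (_mod_)
open import Data.Fin using (Fin; toℕ)
open import Data.Product using (Σ; _×_; _,_)
open import Data.Sum using (_⊎_)
open import Data.Vec using (Vec)
open import Data.Vec.Membership.Propositional using (_∈_)
open import Data.Vec.Relation.Binary.Pointwise.Inductive using (Pointwise)
open import Relation.Nullary using (¬_)

Vertex : ℕ → Set
Vertex n = Fin n × Fin n

-- i ↦ i + a (mod n); subtraction of a is encoded as adding n ∸ a.
shift : ∀ {n} .{{_ : NonZero n}} → ℕ → Fin n → Fin n
shift {n} a i = (toℕ i + a) mod n

-- i ↦ i - a (mod n), for a ≤ n
unshift : ∀ {n} .{{_ : NonZero n}} → ℕ → Fin n → Fin n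
unshift {n} a i = shift (n ∸ a) i

data FootStep {n} .{{_ : NonZero n}} : Vertex n → Vertex n → Set where
  stay  : ∀ {v} → FootStep v v
  up    : ∀ {i j} → FootStep (i , j) (shift 1 i , j)
  down  : ∀ {i j} → FootStep (i , j) (unshift 1 i , j)
  right : ∀ {i j} → FootStep (i , j) (i , shift 1 j)
  left  : ∀ {i j} → FootStep (i , j) (i , unshift 1 j)

data KnightStep {n} .{{_ : NonZero n}} : Vertex n → Vertex n → Set where
  stay : ∀ {v} → KnightStep v v
  k1 : ∀ {i j} → KnightStep (i , j) (shift 1 i , shift 2 j)
  k2 : ∀ {i j} → KnightStep (i , j) (shift 1 i , unshift 2 j)
  k3 : ∀ {i j} → KnightStep (i , j) (unshift 1 i , shift 2 j)
  k4 : ∀ {i j} → KnightStep (i , j) (unshift 1 i , unshift 2 j)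
  k5 : ∀ {i j} → KnightStep (i , j) (shift 2 i , shift 1 j)
  k6 : ∀ {i j} → KnightStep (i , j) (shift 2 i , unshift 1 j)
  k7 : ∀ {i j} → KnightStep (i , j) (unshift 2 i , shift 1 j)
  k8 : ∀ {i j} → KnightStep (i , j) (unshift 2 i , unshift 1 j)

Caught : ∀ {n k} → Vec (Vertex n) k → Vertex n → Set
Caught cs r = r ∈ cs

mutual
  data CopTurnWin {n k} .{{_ : NonZero n}} (cs : Vec (Vertex n) k) (r : Vertex n) : Set where
    copMove : (cs' : Vec (Vertex n) k) → Pointwise KnightStep cs cs' →
              (Caught cs' r ⊎ RobTurnWin cs' r) → CopTurnWin cs r

  data RobTurnWin {n k} .{{_ : NonZero n}} (cs : Vec (Vertex n) k) (r : Vertex n) : Set where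
    robMove : ((r' : Vertex n) → FootStep r r' → Caught cs r' ⊎ CopTurnWin cs r') →
              RobTurnWin cs r

CopsWin : (n : ℕ) .{{_ : NonZero n}} → ℕ → Set
CopsWin n k = Σ (Vec (Vertex n) k) λ cs →
  (r : Vertex n) → Caught cs r ⊎ CopTurnWin cs r

CopNumber : (n : ℕ) .{{_ : NonZero n}} → ℕ → Set
CopNumber n c = CopsWin n c × ((m : ℕ) → m < c → ¬ CopsWin n m)

module Submission where

-- Everything is phrased through the closed knight neighbourhood of a cop:
-- the robber at r is "threatened" by a cop at c if one knight move (or
-- staying) takes c to r.
--
-- Call r safe from c if c does not threaten r.
-- If every safe position admits an escape (for each cop move there is a
-- robber step to a position safe from the cop's new square), then a robber
-- who starts safe is never caught; zero cops trivially lose.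
--
-- Upper bound (two cops win).  "The cops win within t rounds" is defined by
-- recursion on t: for t = 0 some cop threatens the robber, for t + 1 there is
-- a joint cop move after which every robber step leaves a t-round win.  This
-- predicate is decidable and sound for CopTurnWin, so it suffices to exhibit
-- starting squares from which every robber position is a 1-round win.

open import Defs
open import Data.Nat using (ℕ; zero; suc; _<_; NonZero; s≤s)
open import Data.Fin using (Fin; #_) renaming (zero to fz; suc to fs; _≟_ to _≟ᶠ_)
open import Data.Fin.Properties using (all?; any?)
open import Data.Product using (Σ; ∃; ∃-syntax; _×_; _,_)
open import Data.Product.Properties using (≡-dec)
open import Data.Sum using (_⊎_; inj₁; inj₂)
open import Data.Vec using (Vec; []; _∷_; zipWith; head)
open import Data.Vec.Relation.Unary.Any as Any using (Any; here; there)
open import Data.Vec.Relation.Binary.Pointwise.Inductive as Pointwise using (Pointwise; []; _∷_)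
open import Relation.Nullary using (¬_; Dec)
open import Relation.Nullary.Decidable using (from-yes; map′; ¬?; _→-dec_; _⊎-dec_)
open import Relation.Binary.PropositionalEquality using (_≡_; refl; sym)

∃-vec? : ∀ {m k} {P : Vec (Fin m) k → Set} → (∀ xs → Dec (P xs)) → Dec (∃ P)
∃-vec? {k = zero} P? = map′ (λ p → [] , p) (λ { ([] , p) → p }) (P? [])
∃-vec? {k = suc k} P? =
  map′ (λ { (x , xs , p) → x ∷ xs , p }) (λ { (x ∷ xs , p) → x , xs , p })
       (any? λ x → ∃-vec? λ xs → P? (x ∷ xs))

module Torus (n : ℕ) .{{_ : NonZero n}} where

  _≟_ : (u v : Vertex n) → Dec (u ≡ v)
  _≟_ = ≡-dec _≟ᶠ_ _≟ᶠ_

  knight : Fin 9 → Vertex n → Vertex n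
  knight fz c = c
  knight (fs fz) (i , j) = shift 1 i , shift 2 j
  knight (fs (fs fz)) (i , j) = shift 1 i , unshift 2 j
  knight (fs (fs (fs fz))) (i , j) = unshift 1 i , shift 2 j
  knight (fs (fs (fs (fs fz)))) (i , j) = unshift 1 i , unshift 2 j
  knight (fs (fs (fs (fs (fs fz))))) (i , j) = shift 2 i , shift 1 j
  knight (fs (fs (fs (fs (fs (fs fz)))))) (i , j) = shift 2 i , unshift 1 j
  knight (fs (fs (fs (fs (fs (fs (fs fz))))))) (i , j) = unshift 2 i , shift 1 j
  knight (fs (fs (fs (fs (fs (fs (fs (fs fz)))))))) (i , j) = unshift 2 i , unshift 1 j

  knightStep : ∀ e c → KnightStep c (knight e c)
  knightStep fz c = stay
  knightStep (fs fz) (i , j) = k1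
  knightStep (fs (fs fz)) (i , j) = k2
  knightStep (fs (fs (fs fz))) (i , j) = k3
  knightStep (fs (fs (fs (fs fz)))) (i , j) = k4
  knightStep (fs (fs (fs (fs (fs fz))))) (i , j) = k5
  knightStep (fs (fs (fs (fs (fs (fs fz)))))) (i , j) = k6
  knightStep (fs (fs (fs (fs (fs (fs (fs fz))))))) (i , j) = k7
  knightStep (fs (fs (fs (fs (fs (fs (fs (fs fz)))))))) (i , j) = k8

  knightIndex : ∀ {c c'} → KnightStep c c' → ∃[ e ] knight e c ≡ c'
  knightIndex stay = # 0 , refl
  knightIndex k1 = # 1 , refl
  knightIndex k2 = # 2 , refl
  knightIndex k3 = # 3 , refl
  knightIndex k4 = # 4 , refl
  knightIndex k5 = # 5 , refl
  knightIndex k6 = # 6 , refl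
  knightIndex k7 = # 7 , refl
  knightIndex k8 = # 8 , refl

  foot : Fin 5 → Vertex n → Vertex n
  foot fz r = r
  foot (fs fz) (i , j) = shift 1 i , j
  foot (fs (fs fz)) (i , j) = unshift 1 i , j
  foot (fs (fs (fs fz))) (i , j) = i , shift 1 j
  foot (fs (fs (fs (fs fz)))) (i , j) = i , unshift 1 j

  footStep : ∀ d r → FootStep r (foot d r)
  footStep fz r = stay
  footStep (fs fz) (i , j) = up
  footStep (fs (fs fz)) (i , j) = down
  footStep (fs (fs (fs fz))) (i , j) = right
  footStep (fs (fs (fs (fs fz)))) (i , j) = left

  footIndex : ∀ {r r'} → FootStep r r' → ∃[ d ] foot d r ≡ r'
  footIndex stay = # 0 , refl
  footIndex up = # 1 , refl
  footIndex down = # 2 , refl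
  footIndex right = # 3 , refl
  footIndex left = # 4 , refl

  Threatens : Vertex n → Vertex n → Set
  Threatens c r = ∃[ e ] knight e c ≡ r

  ∀-vertex? : {P : Vertex n → Set} → (∀ v → Dec (P v)) → Dec (∀ v → P v)
  ∀-vertex? P? = map′ (λ h → λ { (i , j) → h i j }) (λ h i j → h (i , j))
                      (all? λ i → all? λ j → P? (i , j))

  ∃-vertex? : {P : Vertex n → Set} → (∀ v → Dec (P v)) → Dec (∃ P)
  ∃-vertex? P? = map′ (λ { (i , j , p) → (i , j) , p }) (λ { ((i , j) , p) → i , j , p })
                      (any? λ i → any? λ j → P? (i , j))

  threatens? : ∀ c r → Dec (Threatens c r)
  threatens? c r = any? λ e → knight e c ≟ r

  Safe : Vertex n → Vertex n → Set
  Safe c r = ¬ Threatens c r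

  Escape : Set
  Escape = ∀ c r → Safe c r → ∀ e → ∃[ d ] Safe (knight e c) (foot d r)

  escape? : Dec Escape
  escape? = ∀-vertex? λ c → ∀-vertex? λ r → ¬? (threatens? c r) →-dec
              all? λ e → any? λ d → ¬? (threatens? (knight e c) (foot d r))

  SafeStart : Set
  SafeStart = ∀ c → ∃[ r ] Safe c r

  safeStart? : Dec SafeStart
  safeStart? = ∀-vertex? λ c → ∃-vertex? λ r → ¬? (threatens? c r)

  safe⇒uncaught : ∀ {c r} → Safe c r → ¬ Caught (c ∷ []) r
  safe⇒uncaught s (here r≡c) = s (# 0 , sym r≡c)

  module _ (escape : Escape) where

    -- The robber's invariant: safe before each cop move, hence never caught.
    evade : ∀ {c r} → Safe c r → ¬ CopTurnWin (c ∷ []) r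
    evade {c} {r} s (copMove (c' ∷ []) (step ∷ []) result) with knightIndex step
    ... | e , refl with escape c r s e | result
    ...   | d , s' | inj₁ (here r≡c') = s (e , sym r≡c')
    ...   | d , s' | inj₂ (robMove reply) with reply (foot d r) (footStep d r)
    ...     | inj₁ caught = safe⇒uncaught s' caught
    ...     | inj₂ win = evade s' win

    oneCopLoses : SafeStart → ¬ CopsWin n 1
    oneCopLoses start ((c ∷ []) , win) with start c
    ... | r , s with win r
    ...   | inj₁ caught = safe⇒uncaught s caught
    ...   | inj₂ w = evade s w

  noCopsLose : Vertex n → ¬ CopsWin n 0
  noCopsLose v ([] , win) with win v
  ... | inj₂ w = stayForever w
    where
    stayForever : ∀ {r} → ¬ CopTurnWin [] r
    stayForever {r} (copMove [] [] (inj₂ (robMove reply))) with reply r stay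
    ... | inj₂ w' = stayForever w'

  advance : ∀ {k} → Vec (Fin 9) k → Vec (Vertex n) k → Vec (Vertex n) k
  advance = zipWith knight

  advanceStep : ∀ {k} (es : Vec (Fin 9) k) cs → Pointwise KnightStep cs (advance es cs)
  advanceStep [] [] = []
  advanceStep (e ∷ es) (c ∷ cs) = knightStep e c ∷ advanceStep es cs

  capture : ∀ {k} {cs : Vec (Vertex n) k} {r} → Any (λ c → Threatens c r) cs →
            Σ (Vec (Vertex n) k) λ cs' → Pointwise KnightStep cs cs' × Caught cs' r
  capture {cs = c ∷ cs} (here (e , refl)) =
    knight e c ∷ cs , knightStep e c ∷ Pointwise.refl stay , here refl
  capture {cs = c ∷ cs} (there threat) with capture threat
  ... | cs' , steps , caught = c ∷ cs' , stay ∷ steps , there caught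

  -- The cops (to move) capture the robber within t + 1 of their moves.
  WinWithin : ∀ {k} → ℕ → Vec (Vertex n) k → Vertex n → Set
  WinWithin zero cs r = Any (λ c → Threatens c r) cs
  WinWithin (suc t) cs r =
    WinWithin t cs r ⊎ ∃[ es ] ∀ d → WinWithin t (advance es cs) (foot d r)

  winWithin? : ∀ {k} t (cs : Vec (Vertex n) k) r → Dec (WinWithin t cs r)
  winWithin? zero cs r = Any.any? (λ c → threatens? c r) cs
  winWithin? (suc t) cs r =
    winWithin? t cs r ⊎-dec ∃-vec? λ es → all? λ d → winWithin? t (advance es cs) (foot d r)

  winWithin-sound : ∀ {k} t {cs : Vec (Vertex n) k} {r} → WinWithin t cs r → CopTurnWin cs r
  winWithin-sound zero threat with capture threat
  ... | cs' , steps , caught = copMove cs' steps (inj₁ caught)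
  winWithin-sound (suc t) (inj₁ sooner) = winWithin-sound t sooner
  winWithin-sound (suc t) {cs} {r} (inj₂ (es , win)) =
    copMove (advance es cs) (advanceStep es cs) (inj₂ (robMove reply))
    where
    reply : ∀ r' → FootStep r r' → Caught (advance es cs) r' ⊎ CopTurnWin (advance es cs) r'
    reply r' step with footIndex step
    ... | d , refl = inj₂ (winWithin-sound t (win d))

  copNumberTwo : Escape → SafeStart →
                 (cs : Vec (Vertex n) 2) → (∀ r → WinWithin 1 cs r) → CopNumber n 2
  copNumberTwo escape start cs win = (cs , λ r → inj₂ (winWithin-sound 1 (win r))) , fewer
    where
    fewer : ∀ m → m < 2 → ¬ CopsWin n m
    fewer zero _ = noCopsLose (head cs)
    fewer (suc zero) _ = oneCopLoses escape start
    fewer (suc (suc m)) (s≤s (s≤s ()))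

module Torus₃ = Torus 3
module Torus₄ = Torus 4

theorem1 : CopNumber 3 2 × CopNumber 4 2
theorem1 =
  Torus₃.copNumberTwo (from-yes Torus₃.escape?) (from-yes Torus₃.safeStart?) cops₃
    (from-yes (Torus₃.∀-vertex? λ r → Torus₃.winWithin? 1 cops₃ r)) ,
  Torus₄.copNumberTwo (from-yes Torus₄.escape?) (from-yes Torus₄.safeStart?) cops₄
    (from-yes (Torus₄.∀-vertex? λ r → Torus₄.winWithin? 1 cops₄ r))
  where
  cops₃ : Vec (Vertex 3) 2
  cops₃ = (# 0 , # 0) ∷ (# 0 , # 0) ∷ []

  cops₄ : Vec (Vertex 4) 2
  cops₄ = (# 0 , # 0) ∷ (# 0 , # 1) ∷ []
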